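{- Let $f\in\mathrm{Per}(\mathbb{F}_3^2)\setminus\mathrm{AGL}(2,\mathbb{F}_3)$. Then $1\text{ -coaffinity}(f)\ge 6$. Moreover, letting $\tau$ be any transposition of $\mathbb{F}_3^2$, equality holds if and only if $f\in\mathrm{AGL}(2,\mathbb{F}_3)\circ\tau\circ\mathrm{AGL}(2,\mathbb{F}_3)$.
   Context: $\mathrm{Per}(\mathbb{F}_3^2)$ is the group of permutations of $\mathbb{F}_3^2$ and $\mathrm{AGL}(2,\mathbb{F}_3)$ the group of invertible affine maps of $\mathbb{F}_3^2$. A line is a coset of a $1$-dimensional subspace. $1\text{ -coaffinity}(f)$ is the number of lines $L$ such that $f(L)$ is not a line. A transposition interchanges two distinct points and fixes all others; $\mathrm{AGL}\circ\tau\circ\mathrm{AGL}=\{\alpha\circ\tau\circ\beta:\alpha,\beta\in\mathrm{AGL}(2,\mathbb{F}_3)\}$. -}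

module Defs where

open import Data.Nat using (ℕ; _+_; _*_)
open import Data.Nat.DivMod using (_mod_)
open import Data.Fin using (Fin; zero; suc; toℕ; combine; remQuot; _≟_)
open import Data.Fin.Properties using (any?; all?)
open import Data.Fin.Subset using (Subset; _∈_)
open import Data.Fin.Subset.Properties using (_∈?_)
open import Data.Fin.Permutation using (Permutation′; _⟨$⟩ʳ_; _⟨$⟩ˡ_)
open import Data.Vec using (Vec; []; _∷_; tabulate)
open import Data.List using (List; []; _∷_; _++_; map; filter; length)
open import Data.Product using (Σ; ∃; _×_; _,_; proj₁; proj₂)
open import Data.Bool using (Bool; true; false)
open import Function.Bundles using (_⇔_; mk⇔; Equivalence)
open import Relation.Nullary using (¬_; Dec; yes; no; does)
open import Relation.Nullary.Decidable using (_×-dec_; ¬?)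
open import Relation.Binary.PropositionalEquality using (_≡_; _≢_)

F₃ : Set
F₃ = Fin 3

_+₃_ : F₃ → F₃ → F₃
a +₃ b = (toℕ a + toℕ b) mod 3

_*₃_ : F₃ → F₃ → F₃
a *₃ b = (toℕ a * toℕ b) mod 3

-₃_ : F₃ → F₃
-₃ a = (2 * toℕ a) mod 3

-- The plane F₃², with its 9 points encoded as Fin 9 via the standard
-- bijection Fin 3 × Fin 3 ≅ Fin (3 * 3)  (combine / remQuot).

Point : Set
Point = Fin 9

pt : F₃ → F₃ → Point
pt x y = combine x y

xcoord : Point → F₃
xcoord p = proj₁ (remQuot {3} 3 p)

ycoord : Point → F₃
ycoord p = proj₂ (remQuot {3} 3 p)

origin : Point
origin = pt zero zero

_⊕_ : Point → Point → Point
p ⊕ q = pt (xcoord p +₃ xcoord q) (ycoord p +₃ ycoord q)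

_·_ : F₃ → Point → Point
t · p = pt (t *₃ xcoord p) (t *₃ ycoord p)

IsLine : Subset 9 → Set
IsLine L = ∃ λ (p : Point) → ∃ λ (d : Point) →
  (d ≢ origin) × (∀ x → (x ∈ L) ⇔ (∃ λ (t : F₃) → x ≡ p ⊕ (t · d)))

image : Permutation′ 9 → Subset 9 → Subset 9
image f S = tabulate (λ y → does ((f ⟨$⟩ˡ y) ∈? S))

private
  _⇔?_ : ∀ {A B : Set} → Dec A → Dec B → Dec (A ⇔ B)
  yes a ⇔? yes b = yes (mk⇔ (λ _ → b) (λ _ → a))
  yes a ⇔? no ¬b = no (λ e → ¬b (Equivalence.to e a))
  no ¬a ⇔? yes b = no (λ e → ¬a (Equivalence.from e b))
  no ¬a ⇔? no ¬b = yes (mk⇔ (λ a → Data.Empty.⊥-elim (¬a a)) (λ b → Data.Empty.⊥-elim (¬b b)))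
    where import Data.Empty

isLine? : (L : Subset 9) → Dec (IsLine L)
isLine? L = any? λ p → any? λ d → ¬? (d ≟ origin) ×-dec
  all? (λ x → (x ∈? L) ⇔? any? (λ t → x ≟ (p ⊕ (t · d))))

allSubsets : ∀ n → List (Subset n)
allSubsets ℕ.zero = [] ∷ []
allSubsets (ℕ.suc n) = map (true ∷_) (allSubsets n) ++ map (false ∷_) (allSubsets n)

BadLine : Permutation′ 9 → Subset 9 → Set
BadLine f L = IsLine L × ¬ IsLine (image f L)

badLine? : (f : Permutation′ 9) → (L : Subset 9) → Dec (BadLine f L)
badLine? f L = isLine? L ×-dec ¬? (isLine? (image f L))

coaffinity1 : Permutation′ 9 → ℕ
coaffinity1 f = length (filter (badLine? f) (allSubsets 9))

record AffineMap : Set where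
  field
    a b c d : F₃          -- A = ( a b ; c d )
    e g     : F₃          -- translation vector (e , g)
    invertible : ((a *₃ d) +₃ (-₃ (b *₃ c))) ≢ zero

applyAff : AffineMap → Point → Point
applyAff α p = pt (((a *₃ x) +₃ (b *₃ y)) +₃ e) (((c *₃ x) +₃ (d *₃ y)) +₃ g)
  where
    open AffineMap α
    x = xcoord p
    y = ycoord p

InAGL : Permutation′ 9 → Set
InAGL f = ∃ λ (α : AffineMap) → ∀ x → f ⟨$⟩ʳ x ≡ applyAff α x

InAGLτAGL : Permutation′ 9 → Permutation′ 9 → Set
InAGLτAGL f τ = ∃ λ (α : AffineMap) → ∃ λ (β : AffineMap) →
  ∀ x → f ⟨$⟩ʳ x ≡ applyAff α (τ ⟨$⟩ʳ applyAff β x)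

{-# OPTIONS --safe #-}
-- Composing on the left with an affine map preserves the coaffinity, being affine, and being of the
-- form α ∘ τ ∘ β, so it suffices to study permutations normalised by an affine frame. For a permutation
-- h, at most one of h e₂, h (e₁ + e₂) is the third point of the line through h 0 and h e₁; if h w is
-- not, the affine map φ sending 0, e₁, e₂ to h 0, h e₁, h w turns h into g = φ⁻¹ ∘ h, which fixes 0
-- and e₁ and sends w to e₂. Enumerating these 2 · 6! permutations g shows that each is affine or sends
-- at least 6 lines to non-lines, with exactly 6 only if it is an affine map after a transposition.
-- Conversely a transposition τ_uv breaks exactly the 3 + 3 lines through one of u, v but not both, and
-- as AGL(2, F₃) is 2-transitive, α ∘ τ_uv can be rewritten as α′ ∘ τ_ij ∘ β for any i ≠ j.
module Submission where

open import Defs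
open import Algebra.Bundles using (CommutativeRing)
open import Algebra.Structures using (IsCommutativeRing)
open import Data.Bool using (Bool; true; false; not; _∧_; _∨_; T; if_then_else_)
import Data.Bool as Bool
open import Data.Bool.ListAction using (all)
open import Data.Bool.Properties using (T?; T-∨; T-≡)
open import Data.Empty using (⊥-elim)
open import Data.Fin using (Fin; zero; suc; _≟_)
open import Data.Fin.Patterns using (0F; 1F; 2F; 3F; 4F; 5F; 6F; 7F; 8F)
open import Data.Fin.Properties using (all?; any?; suc-injective; remQuot-combine; combine-remQuot)
open import Data.Fin.Permutation using (Permutation′; transpose; _⟨$⟩ʳ_; _⟨$⟩ˡ_; inverseˡ; inverseʳ)
import Data.Fin.Permutation.Components as Components
open import Data.Fin.Subset using (Subset)
import Data.Fin.Subset.Properties as Subset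
open import Data.List using (List; []; _∷_; [_]; _++_; allFin; cartesianProduct; filter; foldr; length; map)
open import Data.List.Properties using (filter-≐; length-map)
open import Data.List.Membership.Propositional using (_∈_; _∉_)
open import Data.List.Membership.Propositional.Properties using (∈-allFin; ∈-filter⁺; ∈-filter⁻; ∈-map⁺; ∈-++⁺ˡ; ∈-++⁺ʳ)
import Data.List.Membership.DecPropositional as DecMembership
open import Data.List.Relation.Unary.All using () renaming (lookup to All-lookup)
open import Data.List.Relation.Unary.All.Properties using (all⁺)
open import Data.List.Relation.Unary.Any using (here; there)
open import Data.Maybe using (Maybe; just; nothing; is-just; to-witness-T; _<∣>_)
import Data.Maybe as Maybe
open import Data.Nat using (ℕ; _≤_; _≤?_)
import Data.Nat as ℕ
open import Data.Product using (Σ; _×_; _,_; proj₁; proj₂)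
open import Data.Sum using (_⊎_; inj₁; inj₂; [_,_]′)
open import Data.Unit using (⊤; tt)
open import Data.Vec using (Vec; []; _∷_; tabulate; lookup)
open import Data.Vec.Properties using (lookup∘tabulate; tabulate-cong; ≡-dec)
open import Data.Vec.Relation.Binary.Pointwise.Inductive using (Pointwise; []; _∷_; tabulate⁺)
open import Function using (id; _∘_)
open import Function.Bundles using (_⇔_; mk⇔; Equivalence)
import Function.Properties.Equivalence as ⇔
open import Function.Definitions using (Injective)
open import Relation.Binary.Definitions using (DecidableEquality)
open import Relation.Binary.PropositionalEquality using (_≡_; _≢_; refl; sym; trans; cong; cong₂; subst; isEquivalence; module ≡-Reasoning)
open import Relation.Nullary using (¬_; Dec; yes; no; does; ¬?)
open import Relation.Nullary.Decidable using (from-yes; dec-true; dec-false; dec⇒maybe; isYes; toWitness; _→-dec_; _×-dec_)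
open import Relation.Unary using (Decidable)
open import Tactic.RingSolver using (solve-∀)
open import Tactic.RingSolver.Core.AlmostCommutativeRing using (AlmostCommutativeRing; fromCommutativeRing)

cong₃ : ∀ {A B C D : Set} (f : A → B → C → D) {x x′ y y′ z z′} →
  x ≡ x′ → y ≡ y′ → z ≡ z′ → f x y z ≡ f x′ y′ z′
cong₃ f refl refl refl = refl

filter-×-dec : ∀ {A : Set} {P Q : A → Set} (P? : Decidable P) (Q? : Decidable Q) xs →
  filter (λ x → P? x ×-dec Q? x) xs ≡ filter Q? (filter P? xs)
filter-×-dec P? Q? [] = refl
filter-×-dec P? Q? (x ∷ xs) with P? x
... | no _ = filter-×-dec P? Q? xs
... | yes _ with Q? x
...   | yes _ = cong (x ∷_) (filter-×-dec P? Q? xs)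
...   | no _  = filter-×-dec P? Q? xs

filter-map : ∀ {A B : Set} {P : B → Set} (P? : Decidable P) (f : A → B) xs →
  filter P? (map f xs) ≡ map f (filter (P? ∘ f) xs)
filter-map P? f [] = refl
filter-map P? f (x ∷ xs) with does (P? (f x))
... | true  = cong (f x ∷_) (filter-map P? f xs)
... | false = filter-map P? f xs

filter-T?-cong : ∀ {A : Set} {p q : A → Bool} → (∀ x → p x ≡ q x) → ∀ xs →
  filter (T? ∘ p) xs ≡ filter (T? ∘ q) xs
filter-T?-cong p≗q = filter-≐ (T? ∘ _) (T? ∘ _) ((λ {x} → subst T (p≗q x)) , (λ {x} → subst T (sym (p≗q x))))

filter-enumeration-⇔ : ∀ {A : Set} {P : A → Set} (P? : Decidable P) {xs ys} →
  (∀ x → x ∈ xs) → filter P? xs ≡ ys → ∀ x → P x ⇔ x ∈ ys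
filter-enumeration-⇔ P? {xs} complete refl x =
  mk⇔ (∈-filter⁺ P? (complete x)) (λ x∈ys → proj₂ (∈-filter⁻ P? {xs = xs} x∈ys))

does-⇔ : ∀ {A : Set} (A? : Dec A) {b} → does A? ≡ b → A ⇔ T b
does-⇔ (yes a) refl = mk⇔ (λ _ → _) (λ _ → a)
does-⇔ (no ¬a) refl = mk⇔ ¬a (λ ())

¬-⇔-T-not : ∀ {A : Set} {b} → A ⇔ T b → (¬ A) ⇔ T (not b)
¬-⇔-T-not {b = true}  A⇔T = mk⇔ (λ ¬a → ¬a (Equivalence.from A⇔T _)) (λ ())
¬-⇔-T-not {b = false} A⇔T = mk⇔ (λ _ → _) (λ _ → Equivalence.to A⇔T)

transpose-matchˡ : ∀ {n} (i j : Fin n) → Components.transpose i j i ≡ j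
transpose-matchˡ i j with i ≟ i
... | yes _  = refl
... | no i≢i = ⊥-elim (i≢i refl)

transpose-matchʳ : ∀ {n} (i j : Fin n) → Components.transpose i j j ≡ i
transpose-matchʳ i j with j ≟ i
... | yes j≡i = j≡i
... | no _ with j ≟ j
...   | yes _  = refl
...   | no j≢j = ⊥-elim (j≢j refl)

transpose-other : ∀ {n} {i j k : Fin n} → k ≢ i → k ≢ j → Components.transpose i j k ≡ k
transpose-other {i = i} {j} {k} k≢i k≢j with k ≟ i
... | yes k≡i = ⊥-elim (k≢i k≡i)
... | no _ with k ≟ j
...   | yes k≡j = ⊥-elim (k≢j k≡j)
...   | no _    = refl

transpose-conjugate : ∀ {n} (β : Fin n → Fin n) → Injective _≡_ _≡_ β → ∀ {u v i j} → β u ≡ i → β v ≡ j →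
  ∀ x → Components.transpose i j (β x) ≡ β (Components.transpose u v x)
transpose-conjugate β β-inj {u} {v} {i} {j} βu≡i βv≡j x with x ≟ u
... | yes refl = trans (cong (Components.transpose i j) βu≡i) (trans (transpose-matchˡ i j) (sym βv≡j))
... | no x≢u with x ≟ v
...   | yes refl = trans (cong (Components.transpose i j) βv≡j) (trans (transpose-matchʳ i j) (sym βu≡i))
...   | no x≢v   = transpose-other (λ βx≡i → x≢u (β-inj (trans βx≡i (sym βu≡i))))
                                   (λ βx≡j → x≢v (β-inj (trans βx≡j (sym βv≡j))))

module FreshChoices {A : Set} (_≟_ : DecidableEquality A) where

  open import Data.List.Membership.DecPropositional _≟_ using (_∈?_)

  Fresh : List A → ∀ {n} → Vec A n → Set
  Fresh used []       = ⊤
  Fresh used (x ∷ xs) = x ∉ used × Fresh (x ∷ used) xs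

  allFreshChoices : ∀ {n} → Vec (List A) n → List A → (Vec A n → Bool) → Bool
  allFreshChoices []             used P = P []
  allFreshChoices (cands ∷ candss) used P =
    all (λ x → isYes (x ∈? used) ∨ allFreshChoices candss (x ∷ used) (P ∘ (x ∷_))) cands

  allFreshChoices-sound : ∀ {n} (candss : Vec (List A) n) used P → T (allFreshChoices candss used P) →
    ∀ {xs} → Pointwise _∈_ xs candss → Fresh used xs → T (P xs)
  allFreshChoices-sound []               used P ok []                 _               = ok
  allFreshChoices-sound (cands ∷ candss) used P ok {x ∷ xs} (x∈cands ∷ xs∈candss) (x∉used , fresh) =
    allFreshChoices-sound candss (x ∷ used) (P ∘ (x ∷_)) extension-ok xs∈candss fresh
    where
      extension-ok : T (allFreshChoices candss (x ∷ used) (P ∘ (x ∷_)))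
      extension-ok = [ (λ x∈?used → ⊥-elim (x∉used (toWitness {a? = x ∈? used} x∈?used))) , id ]′
                       (Equivalence.to T-∨ (All-lookup (all⁺ _ cands ok) x∈cands))

  tabulate-fresh : ∀ {n} (f : Fin n → A) → Injective _≡_ _≡_ f → ∀ {used} → (∀ i → f i ∉ used) →
    Fresh used (tabulate f)
  tabulate-fresh {ℕ.zero}  f f-inj f∉used = tt
  tabulate-fresh {ℕ.suc n} f f-inj f∉used =
    f∉used zero , tabulate-fresh (f ∘ suc) (suc-injective ∘ f-inj) f-suc∉
    where
      f-suc∉ : ∀ i → f (suc i) ∉ f zero ∷ _
      f-suc∉ i (here f-suc≡f-zero) with () ← f-inj f-suc≡f-zero
      f-suc∉ i (there f-suc∈used)  = f∉used (suc i) f-suc∈used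

-- The field F₃

+₃-assoc : ∀ a b c → (a +₃ b) +₃ c ≡ a +₃ (b +₃ c)
+₃-assoc = from-yes (all? λ a → all? λ b → all? λ c → ((a +₃ b) +₃ c) ≟ (a +₃ (b +₃ c)))

+₃-comm : ∀ a b → a +₃ b ≡ b +₃ a
+₃-comm = from-yes (all? λ a → all? λ b → (a +₃ b) ≟ (b +₃ a))

+₃-identityˡ : ∀ a → 0F +₃ a ≡ a
+₃-identityˡ = from-yes (all? λ a → (0F +₃ a) ≟ a)

+₃-identityʳ : ∀ a → a +₃ 0F ≡ a
+₃-identityʳ = from-yes (all? λ a → (a +₃ 0F) ≟ a)

-₃-inverseˡ : ∀ a → (-₃ a) +₃ a ≡ 0F
-₃-inverseˡ = from-yes (all? λ a → ((-₃ a) +₃ a) ≟ 0F)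

-₃-inverseʳ : ∀ a → a +₃ (-₃ a) ≡ 0F
-₃-inverseʳ = from-yes (all? λ a → (a +₃ (-₃ a)) ≟ 0F)

*₃-assoc : ∀ a b c → (a *₃ b) *₃ c ≡ a *₃ (b *₃ c)
*₃-assoc = from-yes (all? λ a → all? λ b → all? λ c → ((a *₃ b) *₃ c) ≟ (a *₃ (b *₃ c)))

*₃-comm : ∀ a b → a *₃ b ≡ b *₃ a
*₃-comm = from-yes (all? λ a → all? λ b → (a *₃ b) ≟ (b *₃ a))

*₃-identityˡ : ∀ a → 1F *₃ a ≡ a
*₃-identityˡ = from-yes (all? λ a → (1F *₃ a) ≟ a)

*₃-identityʳ : ∀ a → a *₃ 1F ≡ a
*₃-identityʳ = from-yes (all? λ a → (a *₃ 1F) ≟ a)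

*₃-distribˡ-+₃ : ∀ a b c → a *₃ (b +₃ c) ≡ (a *₃ b) +₃ (a *₃ c)
*₃-distribˡ-+₃ = from-yes (all? λ a → all? λ b → all? λ c → (a *₃ (b +₃ c)) ≟ ((a *₃ b) +₃ (a *₃ c)))

*₃-distribʳ-+₃ : ∀ a b c → (b +₃ c) *₃ a ≡ (b *₃ a) +₃ (c *₃ a)
*₃-distribʳ-+₃ = from-yes (all? λ a → all? λ b → all? λ c → ((b +₃ c) *₃ a) ≟ ((b *₃ a) +₃ (c *₃ a)))

F₃-isCommutativeRing : IsCommutativeRing _≡_ _+₃_ _*₃_ -₃_ 0F 1F
F₃-isCommutativeRing = record
  { isRing = record
    { +-isAbelianGroup = record
      { isGroup = record
        { isMonoid = record
          { isSemigroup = record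
            { isMagma = record { isEquivalence = isEquivalence ; ∙-cong = cong₂ _+₃_ }
            ; assoc = +₃-assoc }
          ; identity = +₃-identityˡ , +₃-identityʳ }
        ; inverse = -₃-inverseˡ , -₃-inverseʳ
        ; ⁻¹-cong = cong -₃_ }
      ; comm = +₃-comm }
    ; *-cong = cong₂ _*₃_
    ; *-assoc = *₃-assoc
    ; *-identity = *₃-identityˡ , *₃-identityʳ
    ; distrib = *₃-distribˡ-+₃ , *₃-distribʳ-+₃ }
  ; *-comm = *₃-comm }

F₃-commutativeRing : CommutativeRing _ _
F₃-commutativeRing = record { isCommutativeRing = F₃-isCommutativeRing }

F₃-ring : AlmostCommutativeRing _ _
F₃-ring = fromCommutativeRing F₃-commutativeRing 0≟_
  where
    0≟_ : ∀ x → Maybe (0F ≡ x)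
    0≟ zero  = just refl
    0≟ suc _ = nothing

*₃-nonzero : ∀ a b → a ≢ 0F → b ≢ 0F → a *₃ b ≢ 0F
*₃-nonzero = from-yes (all? λ a → all? λ b → ¬? (a ≟ 0F) →-dec ¬? (b ≟ 0F) →-dec ¬? ((a *₃ b) ≟ 0F))

+₃-triple : ∀ t → (t +₃ t) +₃ t ≡ 0F
+₃-triple = from-yes (all? λ t → ((t +₃ t) +₃ t) ≟ 0F)

-- Affine maps of F₃²

xcoord-pt : ∀ u v → xcoord (pt u v) ≡ u
xcoord-pt u v = cong proj₁ (remQuot-combine {3} {3} u v)

ycoord-pt : ∀ u v → ycoord (pt u v) ≡ v
ycoord-pt u v = cong proj₂ (remQuot-combine {3} {3} u v)

pt-η : ∀ p → pt (xcoord p) (ycoord p) ≡ p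
pt-η p = combine-remQuot {3} 3 p

xcoord-⊕ : ∀ p q → xcoord (p ⊕ q) ≡ xcoord p +₃ xcoord q
xcoord-⊕ p q = xcoord-pt _ (ycoord p +₃ ycoord q)

ycoord-⊕ : ∀ p q → ycoord (p ⊕ q) ≡ ycoord p +₃ ycoord q
ycoord-⊕ p q = ycoord-pt (xcoord p +₃ xcoord q) _

-- applyAff α p is definitionally pt (row a b e p) (row c d g p)
row : F₃ → F₃ → F₃ → Point → F₃
row r s t p = ((r *₃ xcoord p) +₃ (s *₃ ycoord p)) +₃ t

det : F₃ → F₃ → F₃ → F₃ → F₃
det a b c d = (a *₃ d) +₃ (-₃ (b *₃ c))

det-* : ∀ a b c d a′ b′ c′ d′ →
  ((((a *₃ a′) +₃ (b *₃ c′)) *₃ ((c *₃ b′) +₃ (d *₃ d′)))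
    +₃ (-₃ (((a *₃ b′) +₃ (b *₃ d′)) *₃ ((c *₃ a′) +₃ (d *₃ c′)))))
  ≡ ((a *₃ d) +₃ (-₃ (b *₃ c))) *₃ ((a′ *₃ d′) +₃ (-₃ (b′ *₃ c′)))
det-* = solve-∀ F₃-ring

row-∘ : ∀ r s t a b c d e g x y →
  ((((r *₃ a) +₃ (s *₃ c)) *₃ x) +₃ (((r *₃ b) +₃ (s *₃ d)) *₃ y)) +₃ (((r *₃ e) +₃ (s *₃ g)) +₃ t)
  ≡ ((r *₃ (((a *₃ x) +₃ (b *₃ y)) +₃ e)) +₃ (s *₃ (((c *₃ x) +₃ (d *₃ y)) +₃ g))) +₃ t
row-∘ = solve-∀ F₃-ring

infixr 9 _∘ₐ_

_∘ₐ_ : AffineMap → AffineMap → AffineMap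
α ∘ₐ β = record
  { a = (a *₃ a′) +₃ (b *₃ c′) ; b = (a *₃ b′) +₃ (b *₃ d′)
  ; c = (c *₃ a′) +₃ (d *₃ c′) ; d = (c *₃ b′) +₃ (d *₃ d′)
  ; e = ((a *₃ e′) +₃ (b *₃ g′)) +₃ e ; g = ((c *₃ e′) +₃ (d *₃ g′)) +₃ g
  ; invertible = λ det≡0 → *₃-nonzero _ _ invertible invertible′
                   (trans (sym (det-* a b c d a′ b′ c′ d′)) det≡0) }
  where
    open AffineMap α
    open AffineMap β renaming (a to a′; b to b′; c to c′; d to d′; e to e′; g to g′; invertible to invertible′)

applyAff-∘ₐ : ∀ α β p → applyAff (α ∘ₐ β) p ≡ applyAff α (applyAff β p)
applyAff-∘ₐ α β p = cong₂ pt (composed-row a b e) (composed-row c d g)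
  where
    open AffineMap α
    open AffineMap β renaming (a to a′; b to b′; c to c′; d to d′; e to e′; g to g′)
    open ≡-Reasoning
    composed-row : ∀ r s t →
      row ((r *₃ a′) +₃ (s *₃ c′)) ((r *₃ b′) +₃ (s *₃ d′)) (((r *₃ e′) +₃ (s *₃ g′)) +₃ t) p
      ≡ row r s t (applyAff β p)
    composed-row r s t = begin
      row ((r *₃ a′) +₃ (s *₃ c′)) ((r *₃ b′) +₃ (s *₃ d′)) (((r *₃ e′) +₃ (s *₃ g′)) +₃ t) p
        ≡⟨ row-∘ r s t a′ b′ c′ d′ e′ g′ (xcoord p) (ycoord p) ⟩
      ((r *₃ row a′ b′ e′ p) +₃ (s *₃ row c′ d′ g′ p)) +₃ t
        ≡⟨ cong₂ (λ u v → ((r *₃ u) +₃ (s *₃ v)) +₃ t)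
                 (sym (xcoord-pt (row a′ b′ e′ p) (row c′ d′ g′ p)))
                 (sym (ycoord-pt (row a′ b′ e′ p) (row c′ d′ g′ p))) ⟩
      row r s t (applyAff β p) ∎

row-identity : ∀ p → row 1F 0F 0F p ≡ xcoord p × row 0F 1F 0F p ≡ ycoord p
row-identity p = identity (xcoord p) (ycoord p)
  where
    identity : ∀ x y → ((1F *₃ x) +₃ (0F *₃ y)) +₃ 0F ≡ x × ((0F *₃ x) +₃ (1F *₃ y)) +₃ 0F ≡ y
    identity = from-yes (all? λ x → all? λ y →
      (((1F *₃ x) +₃ (0F *₃ y)) +₃ 0F) ≟ x ×-dec (((0F *₃ x) +₃ (1F *₃ y)) +₃ 0F) ≟ y)

IdentityEntries : F₃ → F₃ → F₃ → F₃ → F₃ → F₃ → Set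
IdentityEntries a b c d e g = a ≡ 1F × b ≡ 0F × c ≡ 0F × d ≡ 1F × e ≡ 0F × g ≡ 0F

IsIdentity : AffineMap → Set
IsIdentity γ = IdentityEntries a b c d e g where open AffineMap γ

applyAff-identity : ∀ γ → IsIdentity γ → ∀ p → applyAff γ p ≡ p
applyAff-identity γ (a≡1 , b≡0 , c≡0 , d≡1 , e≡0 , g≡0) p = begin
  pt (row a b e p) (row c d g p)             ≡⟨ cong₂ pt (cong₃ rowAt a≡1 b≡0 e≡0) (cong₃ rowAt c≡0 d≡1 g≡0) ⟩
  pt (row 1F 0F 0F p) (row 0F 1F 0F p)       ≡⟨ cong₂ pt (proj₁ (row-identity p)) (proj₂ (row-identity p)) ⟩
  pt (xcoord p) (ycoord p)                   ≡⟨ pt-η p ⟩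
  p                                          ∎
  where
    open AffineMap γ
    open ≡-Reasoning
    rowAt : F₃ → F₃ → F₃ → F₃
    rowAt r s t = row r s t p

identityEntries? : ∀ a b c d e g → Dec (IdentityEntries a b c d e g)
identityEntries? a b c d e g = a ≟ 1F ×-dec b ≟ 0F ×-dec c ≟ 0F ×-dec d ≟ 1F ×-dec e ≟ 0F ×-dec g ≟ 0F

-- the inverse of x ↦ A x + t is x ↦ δ adj(A) x − δ adj(A) t, since δ = det A satisfies δ² = 1
module InverseEntries (a b c d e g : F₃) where
  δ a⁻ b⁻ c⁻ d⁻ e⁻ g⁻ : F₃
  δ  = det a b c d
  a⁻ = δ *₃ d
  b⁻ = δ *₃ (-₃ b)
  c⁻ = δ *₃ (-₃ c)
  d⁻ = δ *₃ a
  e⁻ = -₃ ((a⁻ *₃ e) +₃ (b⁻ *₃ g))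
  g⁻ = -₃ ((c⁻ *₃ e) +₃ (d⁻ *₃ g))

inverse-entries : ∀ a b c d e g → det a b c d ≢ 0F → let open InverseEntries a b c d e g in
  det a⁻ b⁻ c⁻ d⁻ ≢ 0F ×
  IdentityEntries ((a⁻ *₃ a) +₃ (b⁻ *₃ c)) ((a⁻ *₃ b) +₃ (b⁻ *₃ d))
                  ((c⁻ *₃ a) +₃ (d⁻ *₃ c)) ((c⁻ *₃ b) +₃ (d⁻ *₃ d))
                  (((a⁻ *₃ e) +₃ (b⁻ *₃ g)) +₃ e⁻) (((c⁻ *₃ e) +₃ (d⁻ *₃ g)) +₃ g⁻) ×
  IdentityEntries ((a *₃ a⁻) +₃ (b *₃ c⁻)) ((a *₃ b⁻) +₃ (b *₃ d⁻))
                  ((c *₃ a⁻) +₃ (d *₃ c⁻)) ((c *₃ b⁻) +₃ (d *₃ d⁻))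
                  (((a *₃ e⁻) +₃ (b *₃ g⁻)) +₃ e) (((c *₃ e⁻) +₃ (d *₃ g⁻)) +₃ g)
inverse-entries = from-yes (all? λ a → all? λ b → all? λ c → all? λ d → all? λ e → all? λ g →
  let open InverseEntries a b c d e g in
  ¬? (det a b c d ≟ 0F) →-dec
    (¬? (det a⁻ b⁻ c⁻ d⁻ ≟ 0F) ×-dec
     identityEntries? ((a⁻ *₃ a) +₃ (b⁻ *₃ c)) ((a⁻ *₃ b) +₃ (b⁻ *₃ d))
                      ((c⁻ *₃ a) +₃ (d⁻ *₃ c)) ((c⁻ *₃ b) +₃ (d⁻ *₃ d))
                      (((a⁻ *₃ e) +₃ (b⁻ *₃ g)) +₃ e⁻) (((c⁻ *₃ e) +₃ (d⁻ *₃ g)) +₃ g⁻) ×-dec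
     identityEntries? ((a *₃ a⁻) +₃ (b *₃ c⁻)) ((a *₃ b⁻) +₃ (b *₃ d⁻))
                      ((c *₃ a⁻) +₃ (d *₃ c⁻)) ((c *₃ b⁻) +₃ (d *₃ d⁻))
                      (((a *₃ e⁻) +₃ (b *₃ g⁻)) +₃ e) (((c *₃ e⁻) +₃ (d *₃ g⁻)) +₃ g)))

_⁻¹ₐ : AffineMap → AffineMap
α ⁻¹ₐ = record { a = a⁻ ; b = b⁻ ; c = c⁻ ; d = d⁻ ; e = e⁻ ; g = g⁻
               ; invertible = proj₁ (inverse-entries a b c d e g invertible) }
  where
    open AffineMap α
    open InverseEntries a b c d e g

applyAff-inverseˡ : ∀ α p → applyAff (α ⁻¹ₐ) (applyAff α p) ≡ p
applyAff-inverseˡ α p = trans (sym (applyAff-∘ₐ (α ⁻¹ₐ) α p)) (applyAff-identity (α ⁻¹ₐ ∘ₐ α) left p)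
  where
    open AffineMap α
    left : IsIdentity (α ⁻¹ₐ ∘ₐ α)
    left = proj₁ (proj₂ (inverse-entries a b c d e g invertible))

applyAff-inverseʳ : ∀ α p → applyAff α (applyAff (α ⁻¹ₐ) p) ≡ p
applyAff-inverseʳ α p = trans (sym (applyAff-∘ₐ α (α ⁻¹ₐ) p)) (applyAff-identity (α ∘ₐ α ⁻¹ₐ) right p)
  where
    open AffineMap α
    right : IsIdentity (α ∘ₐ α ⁻¹ₐ)
    right = proj₂ (proj₂ (inverse-entries a b c d e g invertible))

applyAff-injective : ∀ α {p q} → applyAff α p ≡ applyAff α q → p ≡ q
applyAff-injective α {p} {q} αp≡αq = begin
  p                                  ≡⟨ sym (applyAff-inverseˡ α p) ⟩
  applyAff (α ⁻¹ₐ) (applyAff α p)    ≡⟨ cong (applyAff (α ⁻¹ₐ)) αp≡αq ⟩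
  applyAff (α ⁻¹ₐ) (applyAff α q)    ≡⟨ applyAff-inverseˡ α q ⟩
  q                                  ∎
  where open ≡-Reasoning

xcoord-applyAff : ∀ α p → xcoord (applyAff α p) ≡ row (AffineMap.a α) (AffineMap.b α) (AffineMap.e α) p
xcoord-applyAff α p = xcoord-pt _ (row (AffineMap.c α) (AffineMap.d α) (AffineMap.g α) p)

ycoord-applyAff : ∀ α p → ycoord (applyAff α p) ≡ row (AffineMap.c α) (AffineMap.d α) (AffineMap.g α) p
ycoord-applyAff α p = ycoord-pt (row (AffineMap.a α) (AffineMap.b α) (AffineMap.e α) p) _

rows-+ : ∀ r s t x₁ x₂ y₁ y₂ z₁ z₂ →
  ((((r *₃ x₁) +₃ (s *₃ x₂)) +₃ t) +₃ (((r *₃ y₁) +₃ (s *₃ y₂)) +₃ t))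
    +₃ (((r *₃ z₁) +₃ (s *₃ z₂)) +₃ t)
  ≡ ((r *₃ ((x₁ +₃ y₁) +₃ z₁)) +₃ (s *₃ ((x₂ +₃ y₂) +₃ z₂))) +₃ ((t +₃ t) +₃ t)
rows-+ = solve-∀ F₃-ring

-- the translation parts cancel in a sum of three points, as 3 = 0 in F₃
row-⊕ : ∀ r s t x y z → (row r s t x +₃ row r s t y) +₃ row r s t z ≡ row r s 0F ((x ⊕ y) ⊕ z)
row-⊕ r s t x y z = begin
  (row r s t x +₃ row r s t y) +₃ row r s t z
    ≡⟨ rows-+ r s t (xcoord x) (ycoord x) (xcoord y) (ycoord y) (xcoord z) (ycoord z) ⟩
  ((r *₃ ((xcoord x +₃ xcoord y) +₃ xcoord z)) +₃ (s *₃ ((ycoord x +₃ ycoord y) +₃ ycoord z))) +₃ ((t +₃ t) +₃ t)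
    ≡⟨ cong₂ (λ u v → ((r *₃ u) +₃ (s *₃ v)) +₃ ((t +₃ t) +₃ t)) (sym xsum) (sym ysum) ⟩
  ((r *₃ xcoord ((x ⊕ y) ⊕ z)) +₃ (s *₃ ycoord ((x ⊕ y) ⊕ z))) +₃ ((t +₃ t) +₃ t)
    ≡⟨ cong (((r *₃ xcoord ((x ⊕ y) ⊕ z)) +₃ (s *₃ ycoord ((x ⊕ y) ⊕ z))) +₃_) (+₃-triple t) ⟩
  row r s 0F ((x ⊕ y) ⊕ z) ∎
  where
    open ≡-Reasoning
    xsum : xcoord ((x ⊕ y) ⊕ z) ≡ (xcoord x +₃ xcoord y) +₃ xcoord z
    xsum = trans (xcoord-⊕ (x ⊕ y) z) (cong (_+₃ xcoord z) (xcoord-⊕ x y))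
    ysum : ycoord ((x ⊕ y) ⊕ z) ≡ (ycoord x +₃ ycoord y) +₃ ycoord z
    ysum = trans (ycoord-⊕ (x ⊕ y) z) (cong (_+₃ ycoord z) (ycoord-⊕ x y))

linearPart : AffineMap → AffineMap
linearPart α = record α { e = 0F ; g = 0F }

⊕-applyAff : ∀ α x y z →
  (applyAff α x ⊕ applyAff α y) ⊕ applyAff α z ≡ applyAff (linearPart α) ((x ⊕ y) ⊕ z)
⊕-applyAff α x y z = cong₂ pt
  (trans (cong₂ _+₃_ (trans (xcoord-⊕ (applyAff α x) (applyAff α y))
                            (cong₂ _+₃_ (xcoord-applyAff α x) (xcoord-applyAff α y)))
                     (xcoord-applyAff α z))
         (row-⊕ a b e x y z))
  (trans (cong₂ _+₃_ (trans (ycoord-⊕ (applyAff α x) (applyAff α y))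
                            (cong₂ _+₃_ (ycoord-applyAff α x) (ycoord-applyAff α y)))
                     (ycoord-applyAff α z))
         (row-⊕ c d g x y z))
  where open AffineMap α

linearPart-origin : ∀ α → applyAff (linearPart α) origin ≡ origin
linearPart-origin α = cong₂ pt (vanishes a b) (vanishes c d)
  where
    open AffineMap α
    vanishes : ∀ r s → ((r *₃ 0F) +₃ (s *₃ 0F)) +₃ 0F ≡ 0F
    vanishes = from-yes (all? λ r → all? λ s → (((r *₃ 0F) +₃ (s *₃ 0F)) +₃ 0F) ≟ 0F)

infix 7 _==_

_==_ : Point → Point → Bool
p == q = does (p ≟ q)

==-injective : ∀ (h : Point → Point) → Injective _≡_ _≡_ h → ∀ p q → (h p == h q) ≡ (p == q)
==-injective h h-inj p q with p ≟ q
... | yes refl = dec-true (h p ≟ h p) refl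
... | no p≢q   = dec-false (h p ≟ h q) (p≢q ∘ h-inj)

-- distinct x, y, z of F₃² are collinear iff x + y + z = 0, and x + y + z = 0 with x ≠ y forces distinctness
collinear : Point → Point → Point → Bool
collinear x y z = not (x == y) ∧ ((x ⊕ y) ⊕ z == origin)

collinear-applyAff : ∀ α x y z → collinear (applyAff α x) (applyAff α y) (applyAff α z) ≡ collinear x y z
collinear-applyAff α x y z =
  cong₂ (λ u v → not u ∧ v) (==-injective (applyAff α) (applyAff-injective α) x y) (begin
    (applyAff α x ⊕ applyAff α y) ⊕ applyAff α z == origin
      ≡⟨ cong₂ _==_ (⊕-applyAff α x y z) (sym (linearPart-origin α)) ⟩
    applyAff (linearPart α) ((x ⊕ y) ⊕ z) == applyAff (linearPart α) origin
      ≡⟨ ==-injective (applyAff (linearPart α)) (applyAff-injective (linearPart α)) ((x ⊕ y) ⊕ z) origin ⟩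
    (x ⊕ y) ⊕ z == origin ∎)
  where open ≡-Reasoning

collinear-third-unique : ∀ p q r r′ → collinear p q r ≡ true → collinear p q r′ ≡ true → r ≡ r′
collinear-third-unique = from-yes (all? λ p → all? λ q → all? λ r → all? λ r′ →
  (collinear p q r Bool.≟ true) →-dec (collinear p q r′ Bool.≟ true) →-dec (r ≟ r′))

noncollinear-third : ∀ u v → u ≢ v → Σ Point λ w → w ≢ u × w ≢ v × collinear u v w ≡ false
noncollinear-third = from-yes (all? λ u → all? λ v → ¬? (u ≟ v) →-dec
  any? λ w → ¬? (w ≟ u) ×-dec ¬? (w ≟ v) ×-dec (collinear u v w Bool.≟ false))

e₁ e₂ e₁₂ : Point
e₁  = pt 1F 0F
e₂  = pt 0F 1F
e₁₂ = pt 1F 1F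

module _ (p q r : Point) where
  private
    δx δy : Point → F₃
    δx s = xcoord s +₃ (-₃ xcoord p)
    δy s = ycoord s +₃ (-₃ ycoord p)

  frameDet : F₃
  frameDet = det (δx q) (δx r) (δy q) (δy r)

  frameMap : Point → Point
  frameMap x = pt (row (δx q) (δx r) (xcoord p) x) (row (δy q) (δy r) (ycoord p) x)

  frame : frameDet ≢ 0F → AffineMap
  frame invertible = record { a = δx q ; b = δx r ; c = δy q ; d = δy r ; e = xcoord p ; g = ycoord p
                            ; invertible = invertible }

frameMap-basis : ∀ p q r → frameMap p q r origin ≡ p × frameMap p q r e₁ ≡ q × frameMap p q r e₂ ≡ r
frameMap-basis = from-yes (all? λ p → all? λ q → all? λ r →
  frameMap p q r origin ≟ p ×-dec frameMap p q r e₁ ≟ q ×-dec frameMap p q r e₂ ≟ r)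

frameDet-nonzero : ∀ p q r → p ≢ q → r ≢ p → r ≢ q → collinear p q r ≡ false → frameDet p q r ≢ 0F
frameDet-nonzero = from-yes (all? λ p → all? λ q → all? λ r →
  ¬? (p ≟ q) →-dec ¬? (r ≟ p) →-dec ¬? (r ≟ q) →-dec (collinear p q r Bool.≟ false) →-dec ¬? (frameDet p q r ≟ 0F))

frame-through : ∀ {u v} → u ≢ v → Σ AffineMap λ φ → applyAff φ origin ≡ u × applyAff φ e₁ ≡ v
frame-through {u} {v} u≢v = through (noncollinear-third u v u≢v)
  where
    through : (Σ Point λ w → w ≢ u × w ≢ v × collinear u v w ≡ false) →
              Σ AffineMap λ φ → applyAff φ origin ≡ u × applyAff φ e₁ ≡ v
    through (w , w≢u , w≢v , noncollinear) =
      frame u v w (frameDet-nonzero u v w u≢v w≢u w≢v noncollinear) ,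
      proj₁ (frameMap-basis u v w) , proj₁ (proj₂ (frameMap-basis u v w))

affine-2-transitive : ∀ {u v i j} → u ≢ v → i ≢ j → Σ AffineMap λ β → applyAff β u ≡ i × applyAff β v ≡ j
affine-2-transitive {u} {v} {i} {j} u≢v i≢j = compose (frame-through u≢v) (frame-through i≢j)
  where
    compose : (Σ AffineMap λ φ → applyAff φ origin ≡ u × applyAff φ e₁ ≡ v) →
              (Σ AffineMap λ ψ → applyAff ψ origin ≡ i × applyAff ψ e₁ ≡ j) →
              Σ AffineMap λ β → applyAff β u ≡ i × applyAff β v ≡ j
    compose (φ , φ0≡u , φ1≡v) (ψ , ψ0≡i , ψ1≡j) =
      ψ ∘ₐ φ ⁻¹ₐ , via {origin} φ0≡u ψ0≡i , via {e₁} φ1≡v ψ1≡j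
      where
        via : ∀ {b s t} → applyAff φ b ≡ s → applyAff ψ b ≡ t → applyAff (ψ ∘ₐ φ ⁻¹ₐ) s ≡ t
        via {b} refl ψb≡t = begin
          applyAff (ψ ∘ₐ φ ⁻¹ₐ) (applyAff φ b)         ≡⟨ applyAff-∘ₐ ψ (φ ⁻¹ₐ) (applyAff φ b) ⟩
          applyAff ψ (applyAff (φ ⁻¹ₐ) (applyAff φ b)) ≡⟨ cong (applyAff ψ) (applyAff-inverseˡ φ b) ⟩
          applyAff ψ b                                 ≡⟨ ψb≡t ⟩
          _                                            ∎
          where open ≡-Reasoning

-- Lines and coaffinity

Triple : Set
Triple = Point × Point × Point

lineThrough : Triple → Subset 9
lineThrough (x , y , z) = tabulate λ w → (w == x ∨ w == y) ∨ w == z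

-- the point pt x y is numbered 3x + y
lineTriples : List Triple
lineTriples =
  (0F , 1F , 2F) ∷ (0F , 3F , 6F) ∷ (0F , 4F , 8F) ∷ (0F , 5F , 7F) ∷
  (1F , 3F , 8F) ∷ (1F , 4F , 7F) ∷ (1F , 5F , 6F) ∷ (2F , 3F , 7F) ∷
  (2F , 4F , 6F) ∷ (2F , 5F , 8F) ∷ (3F , 4F , 5F) ∷ (6F , 7F , 8F) ∷ []

lineSubsets : List (Subset 9)
lineSubsets = map lineThrough lineTriples

allSubsets-complete : ∀ n (S : Subset n) → S ∈ allSubsets n
allSubsets-complete ℕ.zero    []          = here refl
allSubsets-complete (ℕ.suc n) (true ∷ S)  = ∈-++⁺ˡ (∈-map⁺ (true ∷_) (allSubsets-complete n S))
allSubsets-complete (ℕ.suc n) (false ∷ S) =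
  ∈-++⁺ʳ (map (true ∷_) (allSubsets n)) (∈-map⁺ (false ∷_) (allSubsets-complete n S))

lines-enumerated : filter isLine? (allSubsets 9) ≡ lineSubsets
lines-enumerated = refl

isLine⇔∈lineSubsets : ∀ S → IsLine S ⇔ S ∈ lineSubsets
isLine⇔∈lineSubsets = filter-enumeration-⇔ {P = IsLine} isLine? (allSubsets-complete 9) lines-enumerated

open DecMembership (≡-dec {n = 9} Bool._≟_) using () renaming (_∈?_ to _∈ₛ?_)

lineThrough-∈lineSubsets : ∀ x y z → does (lineThrough (x , y , z) ∈ₛ? lineSubsets) ≡ collinear x y z
lineThrough-∈lineSubsets = from-yes (all? λ x → all? λ y → all? λ z →
  does (lineThrough (x , y , z) ∈ₛ? lineSubsets) Bool.≟ collinear x y z)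

isLine-lineThrough : ∀ x y z → IsLine (lineThrough (x , y , z)) ⇔ T (collinear x y z)
isLine-lineThrough x y z = ⇔.trans (isLine⇔∈lineSubsets _)
  (does-⇔ (lineThrough (x , y , z) ∈ₛ? lineSubsets) (lineThrough-∈lineSubsets x y z))

does-∈? : ∀ {n} (x : Fin n) (S : Subset n) → does (x Subset.∈? S) ≡ lookup S x
does-∈? zero    (true ∷ S)  = refl
does-∈? zero    (false ∷ S) = refl
does-∈? (suc x) (_ ∷ S)     = does-∈? x S

==-⟨$⟩ˡ : ∀ (f : Permutation′ 9) w x → ((f ⟨$⟩ˡ w) == x) ≡ (w == (f ⟨$⟩ʳ x))
==-⟨$⟩ˡ f w x with w ≟ f ⟨$⟩ʳ x
... | yes refl = dec-true (f ⟨$⟩ˡ (f ⟨$⟩ʳ x) ≟ x) (inverseˡ f)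
... | no w≢fx  = dec-false (f ⟨$⟩ˡ w ≟ x)
                   (λ f⁻¹w≡x → w≢fx (trans (sym (inverseʳ f)) (cong (f ⟨$⟩ʳ_) f⁻¹w≡x)))

image-lineThrough : ∀ f x y z → image f (lineThrough (x , y , z)) ≡ lineThrough (f ⟨$⟩ʳ x , f ⟨$⟩ʳ y , f ⟨$⟩ʳ z)
image-lineThrough f x y z = tabulate-cong λ w → begin
  does ((f ⟨$⟩ˡ w) Subset.∈? lineThrough (x , y , z))
    ≡⟨ does-∈? (f ⟨$⟩ˡ w) (lineThrough (x , y , z)) ⟩
  lookup (lineThrough (x , y , z)) (f ⟨$⟩ˡ w)
    ≡⟨ lookup∘tabulate (λ v → (v == x ∨ v == y) ∨ v == z) (f ⟨$⟩ˡ w) ⟩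
  ((f ⟨$⟩ˡ w) == x ∨ (f ⟨$⟩ˡ w) == y) ∨ (f ⟨$⟩ˡ w) == z
    ≡⟨ cong₂ _∨_ (cong₂ _∨_ (==-⟨$⟩ˡ f w x) (==-⟨$⟩ˡ f w y)) (==-⟨$⟩ˡ f w z) ⟩
  (w == (f ⟨$⟩ʳ x) ∨ w == (f ⟨$⟩ʳ y)) ∨ w == (f ⟨$⟩ʳ z) ∎
  where open ≡-Reasoning

collinearImage : (Point → Point) → Triple → Bool
collinearImage h (x , y , z) = collinear (h x) (h y) (h z)

coaffinity : (Point → Point) → ℕ
coaffinity h = length (filter (T? ∘ not ∘ collinearImage h) lineTriples)

coaffinity-cong : ∀ {h h′} → (∀ x → h x ≡ h′ x) → coaffinity h ≡ coaffinity h′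
coaffinity-cong h≗h′ = cong length (filter-T?-cong
  (λ { (x , y , z) → cong not (cong₃ collinear (h≗h′ x) (h≗h′ y) (h≗h′ z)) }) lineTriples)

coaffinity-applyAff : ∀ α h → coaffinity (applyAff α ∘ h) ≡ coaffinity h
coaffinity-applyAff α h = cong length (filter-T?-cong
  (λ { (x , y , z) → cong not (collinear-applyAff α (h x) (h y) (h z)) }) lineTriples)

coaffinity-transpose : ∀ {u v} → u ≢ v → coaffinity (Components.transpose u v) ≡ 6
coaffinity-transpose {u} {v} =
  from-yes (all? λ u → all? λ v → ¬? (u ≟ v) →-dec coaffinity (Components.transpose u v) ℕ.≟ 6) u v

-- stated for an arbitrary list so that checking it never evaluates isLine? on allSubsets 9
badLines-count : ∀ f {xs} → filter isLine? xs ≡ lineSubsets → length (filter (badLine? f) xs) ≡ coaffinity (f ⟨$⟩ʳ_)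
badLines-count f {xs} xs-lines = begin
  length (filter (badLine? f) xs)
    ≡⟨ cong length (filter-×-dec isLine? nonLineImage? xs) ⟩
  length (filter nonLineImage? (filter isLine? xs))
    ≡⟨ cong (λ S → length (filter nonLineImage? S)) xs-lines ⟩
  length (filter nonLineImage? (map lineThrough lineTriples))
    ≡⟨ cong length (filter-map nonLineImage? lineThrough lineTriples) ⟩
  length (map lineThrough (filter (nonLineImage? ∘ lineThrough) lineTriples))
    ≡⟨ length-map lineThrough (filter (nonLineImage? ∘ lineThrough) lineTriples) ⟩
  length (filter (nonLineImage? ∘ lineThrough) lineTriples)
    ≡⟨ cong length (filter-≐ (nonLineImage? ∘ lineThrough) (T? ∘ not ∘ collinearImage h)
                      ((λ {t} → Equivalence.to (image-noncollinear t)) , (λ {t} → Equivalence.from (image-noncollinear t)))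
                      lineTriples) ⟩
  coaffinity h ∎
  where
    open ≡-Reasoning
    h : Point → Point
    h = f ⟨$⟩ʳ_
    NonLineImage : Subset 9 → Set
    NonLineImage L = ¬ IsLine (image f L)
    nonLineImage? : Decidable NonLineImage
    nonLineImage? L = ¬? (isLine? (image f L))
    image-noncollinear : ∀ t → NonLineImage (lineThrough t) ⇔ T (not (collinearImage h t))
    image-noncollinear (x , y , z) = ¬-⇔-T-not
      (subst (λ S → IsLine S ⇔ T (collinear (h x) (h y) (h z))) (sym (image-lineThrough f x y z))
             (isLine-lineThrough (h x) (h y) (h z)))

coaffinity1≡coaffinity : ∀ f → coaffinity1 f ≡ coaffinity (f ⟨$⟩ʳ_)
coaffinity1≡coaffinity f = badLines-count f {allSubsets 9} lines-enumerated

-- The dichotomy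

Affine : (Point → Point) → Set
Affine h = Σ AffineMap λ α → ∀ x → h x ≡ applyAff α x

AffineAfterTransposition : (Point → Point) → Set
AffineAfterTransposition h =
  Σ AffineMap λ α → Σ Point λ u → Σ Point λ v → u ≢ v × ∀ x → h x ≡ applyAff α (Components.transpose u v x)

Bound : (Point → Point) → Set
Bound h = 6 ≤ coaffinity h × (coaffinity h ≡ 6 → AffineAfterTransposition h)

Dichotomy : (Point → Point) → Set
Dichotomy h = Affine h ⊎ Bound h

Dichotomy-transport : ∀ α {g h} → (∀ x → h x ≡ applyAff α (g x)) → Dichotomy g → Dichotomy h
Dichotomy-transport α {g} {h} h≡αg (inj₁ (β , g≡β)) = inj₁ (α ∘ₐ β , λ x → begin
  h x                         ≡⟨ h≡αg x ⟩
  applyAff α (g x)            ≡⟨ cong (applyAff α) (g≡β x) ⟩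
  applyAff α (applyAff β x)   ≡⟨ applyAff-∘ₐ α β x ⟨
  applyAff (α ∘ₐ β) x         ∎)
  where open ≡-Reasoning
Dichotomy-transport α {g} {h} h≡αg (inj₂ (6≤g , g≡6⇒τ)) =
  inj₂ (subst (6 ≤_) (sym h≡g) 6≤g , λ h≡6 → transport (g≡6⇒τ (trans (sym h≡g) h≡6)))
  where
    h≡g : coaffinity h ≡ coaffinity g
    h≡g = trans (coaffinity-cong h≡αg) (coaffinity-applyAff α g)
    transport : AffineAfterTransposition g → AffineAfterTransposition h
    transport (β , u , v , u≢v , g≡βτ) = α ∘ₐ β , u , v , u≢v , λ x →
      trans (h≡αg x) (trans (cong (applyAff α) (g≡βτ x)) (sym (applyAff-∘ₐ α β (Components.transpose u v x))))

-- an affine h must be the frame map through h origin, h e₁, h e₂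
affine? : ∀ h → Maybe (Affine h)
affine? h = viaFrame (frameDet (h origin) (h e₁) (h e₂) ≟ 0F)
  where
    viaFrame : Dec (frameDet (h origin) (h e₁) (h e₂) ≡ 0F) → Maybe (Affine h)
    viaFrame (yes _)    = nothing
    viaFrame (no det≢0) = Maybe.map (φ ,_) (dec⇒maybe (all? λ x → h x ≟ applyAff φ x))
      where φ = frame (h origin) (h e₁) (h e₂) det≢0

affineAfterTransposition? : ∀ h → Maybe (AffineAfterTransposition h)
affineAfterTransposition? h = foldr _<∣>_ nothing (map candidate (cartesianProduct (allFin 9) (allFin 9)))
  where
    candidate : Point × Point → Maybe (AffineAfterTransposition h)
    candidate (u , v) with u ≟ v
    ... | yes _   = nothing
    ... | no u≢v = Maybe.map undo (affine? (h ∘ Components.transpose v u))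
      where
        undo : Affine (h ∘ Components.transpose v u) → AffineAfterTransposition h
        undo (α , hτ≡α) = α , u , v , u≢v , λ x →
          trans (cong h (sym (Components.transpose-inverse v u))) (hτ≡α (Components.transpose u v x))

bound? : ∀ h → Maybe (Bound h)
bound? h = fromCount (coaffinity h) refl
  where
    fromCount : ∀ k → coaffinity h ≡ k → Maybe (Bound h)
    fromCount k h≡k = decide (6 ≤? k) (k ℕ.≟ 6)
      where
        6≤h : 6 ≤ k → 6 ≤ coaffinity h
        6≤h = subst (6 ≤_) (sym h≡k)
        decide : Dec (6 ≤ k) → Dec (k ≡ 6) → Maybe (Bound h)
        decide (no _)    _        = nothing
        decide (yes 6≤k) (no k≢6) = just (6≤h 6≤k , λ h≡6 → ⊥-elim (k≢6 (trans (sym h≡k) h≡6)))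
        decide (yes 6≤k) (yes _)  = Maybe.map (λ t → 6≤h 6≤k , λ _ → t) (affineAfterTransposition? h)

dichotomy? : ∀ h → Maybe (Dichotomy h)
dichotomy? h = Maybe.map inj₁ (affine? h) <∣> Maybe.map inj₂ (bound? h)

-- Permutations normalised by an affine frame

open FreshChoices (_≟_ {9})

Normalised : (Point → Point) → Point → Set
Normalised g w = g origin ≡ origin × g e₁ ≡ e₁ × g w ≡ e₂

candidate : Point → Point → List Point
candidate w x = if x == origin then [ origin ] else if x == e₁ then [ e₁ ] else if x == w then [ e₂ ] else allFin 9

candidate-complete : ∀ {g w} → Normalised g w → ∀ x → g x ∈ candidate w x
candidate-complete {g} {w} (g0 , g1 , gw) x with x ≟ origin
... | yes refl = here g0
... | no _ with x ≟ e₁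
...   | yes refl = here g1
...   | no _ with x ≟ w
...     | yes refl = here gw
...     | no _     = ∈-allFin (g x)

normalisedSearch : Point → Bool
normalisedSearch w = allFreshChoices (tabulate (candidate w)) [] (is-just ∘ dichotomy? ∘ lookup)

-- stated as equations: checking a term of type T (normalisedSearch w) reduces its type, rerunning the search
normalisedSearch-e₂ : normalisedSearch e₂ ≡ true
normalisedSearch-e₂ = refl

normalisedSearch-e₁₂ : normalisedSearch e₁₂ ≡ true
normalisedSearch-e₁₂ = refl

dichotomy-normalised : ∀ w → normalisedSearch w ≡ true → ∀ g → Injective _≡_ _≡_ g → Normalised g w →
  Dichotomy (lookup (tabulate g))
dichotomy-normalised w ok g g-inj normalised = to-witness-T (dichotomy? (lookup (tabulate g)))
  (allFreshChoices-sound (tabulate (candidate w)) [] (is-just ∘ dichotomy? ∘ lookup) (Equivalence.from T-≡ ok)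
                         (tabulate⁺ (candidate-complete {g} {w} normalised)) (tabulate-fresh g g-inj (λ _ ())))

dichotomy-via-frame : ∀ h → Injective _≡_ _≡_ h → ∀ w → w ≢ origin → w ≢ e₁ →
  collinear (h origin) (h e₁) (h w) ≡ false → normalisedSearch w ≡ true → Dichotomy h
dichotomy-via-frame h h-inj w w≢origin w≢e₁ noncollinear ok =
  Dichotomy-transport φ {lookup (tabulate g)} {h} h≡φg (dichotomy-normalised w ok g g-inj normalised)
  where
    basis : frameMap (h origin) (h e₁) (h w) origin ≡ h origin × frameMap (h origin) (h e₁) (h w) e₁ ≡ h e₁ ×
            frameMap (h origin) (h e₁) (h w) e₂ ≡ h w
    basis = frameMap-basis (h origin) (h e₁) (h w)
    origin≢e₁ : origin ≢ e₁
    origin≢e₁ ()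
    φ : AffineMap
    φ = frame (h origin) (h e₁) (h w)
          (frameDet-nonzero (h origin) (h e₁) (h w)
            (origin≢e₁ ∘ h-inj) (w≢origin ∘ h-inj) (w≢e₁ ∘ h-inj) noncollinear)
    g : Point → Point
    g = applyAff (φ ⁻¹ₐ) ∘ h
    g-inj : Injective _≡_ _≡_ g
    g-inj = h-inj ∘ applyAff-injective (φ ⁻¹ₐ)
    fixes : ∀ {b} x → frameMap (h origin) (h e₁) (h w) b ≡ h x → g x ≡ b
    fixes {b} x φb≡hx = trans (cong (applyAff (φ ⁻¹ₐ)) (sym φb≡hx)) (applyAff-inverseˡ φ b)
    normalised : Normalised g w
    normalised = fixes origin (proj₁ basis) , fixes e₁ (proj₁ (proj₂ basis)) , fixes w (proj₂ (proj₂ basis))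
    h≡φg : ∀ x → h x ≡ applyAff φ (lookup (tabulate g) x)
    h≡φg x = begin
      h x                                 ≡⟨ applyAff-inverseʳ φ (h x) ⟨
      applyAff φ (g x)                    ≡⟨ cong (applyAff φ) (lookup∘tabulate g x) ⟨
      applyAff φ (lookup (tabulate g) x)  ∎
      where open ≡-Reasoning

dichotomy : ∀ h → Injective _≡_ _≡_ h → Dichotomy h
dichotomy h h-inj = byCases (collinear (h origin) (h e₁) (h e₂)) refl (collinear (h origin) (h e₁) (h e₁₂)) refl
  where
    e₂≢e₁₂ : e₂ ≢ e₁₂
    e₂≢e₁₂ ()
    -- h e₂ and h e₁₂ cannot both be the third point of the line through h origin and h e₁
    byCases : ∀ b → collinear (h origin) (h e₁) (h e₂) ≡ b →
              ∀ b′ → collinear (h origin) (h e₁) (h e₁₂) ≡ b′ → Dichotomy h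
    byCases false c₂ _     _   = dichotomy-via-frame h h-inj e₂ (λ ()) (λ ()) c₂ normalisedSearch-e₂
    byCases true  _  false c₁₂ = dichotomy-via-frame h h-inj e₁₂ (λ ()) (λ ()) c₁₂ normalisedSearch-e₁₂
    byCases true  c₂ true  c₁₂ =
      ⊥-elim (e₂≢e₁₂ (h-inj (collinear-third-unique (h origin) (h e₁) (h e₂) (h e₁₂) c₂ c₁₂)))

-- Double cosets

DoubleCoset : (Point → Point) → Point → Point → Set
DoubleCoset h i j =
  Σ AffineMap λ α → Σ AffineMap λ β → ∀ x → h x ≡ applyAff α (Components.transpose i j (applyAff β x))

doubleCoset : ∀ {h i j} → i ≢ j → AffineAfterTransposition h → DoubleCoset h i j
doubleCoset {h} {i} {j} i≢j (α , u , v , u≢v , h≡ατ) = conjugated (affine-2-transitive u≢v i≢j)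
  where
    conjugated : (Σ AffineMap λ β → applyAff β u ≡ i × applyAff β v ≡ j) → DoubleCoset h i j
    conjugated (β , βu≡i , βv≡j) = α ∘ₐ β ⁻¹ₐ , β , λ x → begin
      h x
        ≡⟨ h≡ατ x ⟩
      applyAff α (τuv x)
        ≡⟨ cong (applyAff α) (applyAff-inverseˡ β (τuv x)) ⟨
      applyAff α (applyAff (β ⁻¹ₐ) (applyAff β (τuv x)))
        ≡⟨ applyAff-∘ₐ α (β ⁻¹ₐ) (applyAff β (τuv x)) ⟨
      applyAff (α ∘ₐ β ⁻¹ₐ) (applyAff β (τuv x))
        ≡⟨ cong (applyAff (α ∘ₐ β ⁻¹ₐ)) (transpose-conjugate (applyAff β) (applyAff-injective β) βu≡i βv≡j x) ⟨
      applyAff (α ∘ₐ β ⁻¹ₐ) (Components.transpose i j (applyAff β x)) ∎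
      where
        open ≡-Reasoning
        τuv = Components.transpose u v

doubleCoset-coaffinity : ∀ {h i j} → i ≢ j → DoubleCoset h i j → coaffinity h ≡ 6
doubleCoset-coaffinity {h} {i} {j} i≢j (α , β , h≡ατβ) = begin
  coaffinity h                                    ≡⟨ coaffinity-cong h≡αβτ ⟩
  coaffinity (applyAff α ∘ applyAff β ∘ τuv)      ≡⟨ coaffinity-applyAff α (applyAff β ∘ τuv) ⟩
  coaffinity (applyAff β ∘ τuv)                   ≡⟨ coaffinity-applyAff β τuv ⟩
  coaffinity τuv                                  ≡⟨ coaffinity-transpose u≢v ⟩
  6                                               ∎
  where
    open ≡-Reasoning
    u = applyAff (β ⁻¹ₐ) i
    v = applyAff (β ⁻¹ₐ) j
    τuv = Components.transpose u v
    u≢v : u ≢ v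
    u≢v u≡v = i≢j (trans (sym (applyAff-inverseʳ β i)) (trans (cong (applyAff β) u≡v) (applyAff-inverseʳ β j)))
    h≡αβτ : ∀ x → h x ≡ applyAff α (applyAff β (τuv x))
    h≡αβτ x = trans (h≡ατβ x) (cong (applyAff α)
      (transpose-conjugate (applyAff β) (applyAff-injective β) (applyAff-inverseʳ β i) (applyAff-inverseʳ β j) x))

⟨$⟩ʳ-injective : ∀ (f : Permutation′ 9) → Injective _≡_ _≡_ (f ⟨$⟩ʳ_)
⟨$⟩ʳ-injective f {x} {y} fx≡fy = trans (sym (inverseˡ f)) (trans (cong (f ⟨$⟩ˡ_) fx≡fy) (inverseˡ f))

theorem8p2 : (f : Permutation′ 9) → ¬ InAGL f →
    (6 ≤ coaffinity1 f) ×
    ((i j : Fin 9) → i ≢ j →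
      ((coaffinity1 f ≡ 6) ⇔ InAGLτAGL f (transpose i j)))
theorem8p2 f ¬affine = subst (6 ≤_) (sym coaffinities) (proj₁ bound) , λ i j i≢j →
  mk⇔ (λ f≡6 → doubleCoset i≢j (proj₂ bound (trans (sym coaffinities) f≡6)))
      (λ f∈AτA → trans coaffinities (doubleCoset-coaffinity i≢j f∈AτA))
  where
    coaffinities : coaffinity1 f ≡ coaffinity (f ⟨$⟩ʳ_)
    coaffinities = coaffinity1≡coaffinity f
    bound : Bound (f ⟨$⟩ʳ_)
    bound = [ ⊥-elim ∘ ¬affine , id ]′ (dichotomy (f ⟨$⟩ʳ_) (⟨$⟩ʳ-injective f))
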